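{- Fix a mode theory $\mathcal{M}$ (a strict 2-category) and consider the multimodal natural deduction system described in the context. The following cut rule is admissible: for every modality $\mu : n \to m$, every context $\Gamma$ ctx $@\,m$, every pre-context $\Delta$, every mode $b$ and formulas $\varphi,\psi$, if $\Gamma.\mathsf{lock}_\mu \vdash \varphi\ @\,n$ and $\Gamma, (\mu\mid\varphi), \Delta \vdash \psi\ @\,b$ are derivable, then $\Gamma, \Delta \vdash \psi\ @\,b$ is derivable.
   Context: A mode theory is a strict 2-category $\mathcal{M}$. Its objects are called modes; its 1-cells $\mu : n \to m$ are called modalities, with composition $\mu\circ\nu : o \to m$ for $\nu : o\to n$, $\mu : n \to m$, and identities $1_m$; its 2-cells $\alpha : \mu \Rightarrow \nu$ (between parallel modalities) are called transformations, with vertical composition, identities $1_\mu$, and horizontal composition $\alpha * \beta : \mu\circ\theta \Rightarrow \nu\circ\xi$ for $\alpha:\mu\Rightarrow\nu$, $\beta : \theta\Rightarrow\xi$, satisfying the strict 2-category laws. Formulas. Pre-formulas: $\varphi,\psi ::= p_i \mid \bot \mid \top \mid \varphi\lor\psi \mid \varphi\land\psi \mid (\mu\mid\varphi)\to\psi \mid \langle\mu\mid\varphi\rangle$. The judgement "$\varphi$ wff $@\,m$" is generated by: $p_i,\top,\bot$ are wff at every mode; if $\varphi,\psi$ wff $@\,m$ then so are $\varphi\land\psi$, $\varphi\lor\psi$; if $\mu:n\to m$, $\varphi$ wff $@\,n$ and $\psi$ wff $@\,m$ then $(\mu\mid\varphi)\to\psi$ wff $@\,m$; if $\varphi$ wff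 $@\,n$ and $\mu:n\to m$ then $\langle\mu\mid\varphi\rangle$ wff $@\,m$. Contexts. Pre-contexts: $\Gamma ::= \cdot \mid \Gamma, (\mu\mid\varphi) \mid \Gamma.\mathsf{lock}_\mu$. The judgement "$\Gamma$ ctx $@\,m$" is generated by: $\cdot$ ctx $@\,m$; if $\Gamma$ ctx $@\,m$, $\mu : n\to m$ and $\varphi$ wff $@\,n$ then $\Gamma,(\mu\mid\varphi)$ ctx $@\,m$; if $\Gamma$ ctx $@\,m$ and $\mu : n \to m$ then $\Gamma.\mathsf{lock}_\mu$ ctx $@\,n$. Contexts are identified modulo $\Gamma.\mathsf{lock}_{1_m} = \Gamma$ and $\Gamma.\mathsf{lock}_\mu.\mathsf{lock}_\nu = \Gamma.\mathsf{lock}_{\mu\circ\nu}$. $\Gamma,\Delta$ denotes concatenation of pre-contexts. Define $|\cdot| = 1$, $|\Gamma,(\mu\mid\varphi)| = |\Gamma|$, $|\Gamma.\mathsf{lock}_\mu| = |\Gamma|\circ\mu$. Derivability of $\Gamma\vdash\varphi\ @\,m$ is generated by the rules: (var) if $\mu : n\to m$ and $\alpha : \mu\Rightarrow |\Delta|$ then $\Gamma,(\mu\mid\varphi),\Delta \vdash \varphi\ @\,n$; ($\top$) $\Gamma\vdash\top\ @\,m$; ($\bot$E) from $\Gamma\vdash\bot\ @\,m$ infer $\Gamma\vdash\varphi\ @\,m$; ($\land$I) from $\Gamma\vdash\varphi$ and $\Gamma\vdash\psi$ infer $\Gamma\vdash\varphi\land\psi$; ($\land$E) from $\Gamma\vdash\varphi_1\land\varphi_2$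 infer $\Gamma\vdash\varphi_i$; ($\lor$I) from $\Gamma\vdash\varphi_i$ infer $\Gamma\vdash\varphi_1\lor\varphi_2$; ($\lor$E) from $\Gamma\vdash\varphi\lor\psi$, $\Gamma,(1\mid\varphi)\vdash C$, $\Gamma,(1\mid\psi)\vdash C$ infer $\Gamma\vdash C$ (all at the same mode); ($\to$I) from $\Gamma,(\mu\mid\varphi)\vdash\psi\ @\,m$ infer $\Gamma\vdash(\mu\mid\varphi)\to\psi\ @\,m$; ($\to$E) if $\mu:n\to m$, from $\Gamma\vdash(\mu\mid\varphi)\to\psi\ @\,m$ and $\Gamma.\mathsf{lock}_\mu\vdash\varphi\ @\,n$ infer $\Gamma\vdash\psi\ @\,m$; (modI) if $\mu:n\to m$, from $\Gamma.\mathsf{lock}_\mu\vdash\varphi\ @\,n$ infer $\Gamma\vdash\langle\mu\mid\varphi\rangle\ @\,m$; (modE) if $\nu:o\to n$, $\mu:n\to m$, from $\Gamma.\mathsf{lock}_\mu\vdash\langle\nu\mid\varphi\rangle\ @\,n$ and $\Gamma,(\mu\circ\nu\mid\varphi)\vdash\psi\ @\,m$ infer $\Gamma\vdash\psi\ @\,m$. A rule is admissible if whenever its premises are derivable, so is its conclusion. -}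

module Defs where

open import Level using (Level; _⊔_; suc)
open import Data.Nat using (ℕ)
open import Relation.Binary.PropositionalEquality using (_≡_; subst₂)

-- Mode theories: strict 2-categories (equalities of 1- and 2-cells are
-- propositional equality; horizontal associativity/unit laws for 2-cells
-- are stated by transporting along the corresponding strict 1-cell laws).

record ModeTheory (o ℓ₁ ℓ₂ : Level) : Set (suc (o ⊔ ℓ₁ ⊔ ℓ₂)) where
  infixr 9 _∘_
  infixr 9 _·_
  infixr 8 _*_
  field
    Mode : Set o
    Hom  : Mode → Mode → Set ℓ₁
    _∘_  : ∀ {o' n m} → Hom n m → Hom o' n → Hom o' m
    id₁  : ∀ {m} → Hom m m
    ∘-assoc : ∀ {k o' n m} (μ : Hom n m) (ν : Hom o' n) (ρ : Hom k o') →
              (μ ∘ ν) ∘ ρ ≡ μ ∘ (ν ∘ ρ)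
    ∘-idˡ : ∀ {n m} (μ : Hom n m) → id₁ ∘ μ ≡ μ
    ∘-idʳ : ∀ {n m} (μ : Hom n m) → μ ∘ id₁ ≡ μ

    Cell : ∀ {n m} → Hom n m → Hom n m → Set ℓ₂
    _·_  : ∀ {n m} {μ ν ρ : Hom n m} → Cell ν ρ → Cell μ ν → Cell μ ρ
    id₂  : ∀ {n m} {μ : Hom n m} → Cell μ μ
    ·-assoc : ∀ {n m} {μ ν ρ σ : Hom n m}
              (γ : Cell ρ σ) (β : Cell ν ρ) (α : Cell μ ν) →
              (γ · β) · α ≡ γ · (β · α)
    ·-idˡ : ∀ {n m} {μ ν : Hom n m} (α : Cell μ ν) → id₂ · α ≡ α
    ·-idʳ : ∀ {n m} {μ ν : Hom n m} (α : Cell μ ν) → α · id₂ ≡ α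

    _*_  : ∀ {o' n m} {μ ν : Hom n m} {θ ξ : Hom o' n} →
           Cell μ ν → Cell θ ξ → Cell (μ ∘ θ) (ν ∘ ξ)
    *-assoc : ∀ {k o' n m} {μ μ' : Hom n m} {ν ν' : Hom o' n} {ρ ρ' : Hom k o'}
              (α : Cell μ μ') (β : Cell ν ν') (γ : Cell ρ ρ') →
              subst₂ Cell (∘-assoc μ ν ρ) (∘-assoc μ' ν' ρ') ((α * β) * γ)
                ≡ α * (β * γ)
    *-idˡ : ∀ {n m} {μ ν : Hom n m} (α : Cell μ ν) →
            subst₂ Cell (∘-idˡ μ) (∘-idˡ ν) (id₂ {μ = id₁} * α) ≡ α
    *-idʳ : ∀ {n m} {μ ν : Hom n m} (α : Cell μ ν) →
            subst₂ Cell (∘-idʳ μ) (∘-idʳ ν) (α * id₂ {μ = id₁}) ≡ α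
    *-id₂ : ∀ {o' n m} {μ : Hom n m} {ν : Hom o' n} →
            id₂ {μ = μ} * id₂ {μ = ν} ≡ id₂
    interchange : ∀ {o' n m} {μ μ' μ'' : Hom n m} {θ θ' θ'' : Hom o' n}
                  (α' : Cell μ' μ'') (α : Cell μ μ')
                  (β' : Cell θ' θ'') (β : Cell θ θ') →
                  (α' · α) * (β' · β) ≡ (α' * β') · (α * β)

module Syntax {o ℓ₁ ℓ₂} (M : ModeTheory o ℓ₁ ℓ₂) where
  open ModeTheory M

  data Fm : Mode → Set (o ⊔ ℓ₁) where
    p     : ∀ {m} → ℕ → Fm m
    ⊥f ⊤f : ∀ {m} → Fm m
    _∨f_ _∧f_ : ∀ {m} → Fm m → Fm m → Fm m
    [_∣_]⇒_ : ∀ {n m} → Hom n m → Fm n → Fm m → Fm m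
    ⟨_∣_⟩ : ∀ {n m} → Hom n m → Fm n → Fm m

  data Ctx : Mode → Set (o ⊔ ℓ₁) where
    ∙ : ∀ {m} → Ctx m
    _,[_∣_] : ∀ {n m} → Ctx m → Hom n m → Fm n → Ctx m
    _lock_ : ∀ {n m} → Ctx m → Hom n m → Ctx n

  -- Pre-context suffixes Δ which extend a context at mode m to one at mode b
  data Tel (m : Mode) : Mode → Set (o ⊔ ℓ₁) where
    [] : Tel m m
    _,[_∣_] : ∀ {n k} → Tel m k → Hom n k → Fm n → Tel m k
    _lock_ : ∀ {n k} → Tel m k → Hom n k → Tel m n

  _⧺_ : ∀ {m b} → Ctx m → Tel m b → Ctx b
  Γ ⧺ [] = Γ
  Γ ⧺ (Δ ,[ μ ∣ φ ]) = (Γ ⧺ Δ) ,[ μ ∣ φ ]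
  Γ ⧺ (Δ lock μ) = (Γ ⧺ Δ) lock μ

  ∣_∣ : ∀ {m b} → Tel m b → Hom b m
  ∣ [] ∣ = id₁
  ∣ Δ ,[ μ ∣ φ ] ∣ = ∣ Δ ∣
  ∣ Δ lock μ ∣ = ∣ Δ ∣ ∘ μ

  data _≈_ : ∀ {m} → Ctx m → Ctx m → Set (o ⊔ ℓ₁) where
    lock-id   : ∀ {m} (Γ : Ctx m) → (Γ lock id₁) ≈ Γ
    lock-comp : ∀ {o' n m} (Γ : Ctx m) (μ : Hom n m) (ν : Hom o' n) →
                ((Γ lock μ) lock ν) ≈ (Γ lock (μ ∘ ν))
    ≈-refl  : ∀ {m} {Γ : Ctx m} → Γ ≈ Γ
    ≈-sym   : ∀ {m} {Γ Γ' : Ctx m} → Γ ≈ Γ' → Γ' ≈ Γ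
    ≈-trans : ∀ {m} {Γ Γ' Γ'' : Ctx m} → Γ ≈ Γ' → Γ' ≈ Γ'' → Γ ≈ Γ''
    ≈-ext   : ∀ {n m} {Γ Γ' : Ctx m} (μ : Hom n m) (φ : Fm n) →
              Γ ≈ Γ' → (Γ ,[ μ ∣ φ ]) ≈ (Γ' ,[ μ ∣ φ ])
    ≈-lock  : ∀ {n m} {Γ Γ' : Ctx m} (μ : Hom n m) →
              Γ ≈ Γ' → (Γ lock μ) ≈ (Γ' lock μ)

  infix 4 _⊢_
  data _⊢_ : ∀ {m} → Ctx m → Fm m → Set (o ⊔ ℓ₁ ⊔ ℓ₂) where
    -- judgements are about contexts modulo the identification
    conv : ∀ {m} {Γ Γ' : Ctx m} {φ : Fm m} → Γ ≈ Γ' → Γ ⊢ φ → Γ' ⊢ φ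
    var  : ∀ {n m} {Γ : Ctx m} (μ : Hom n m) (φ : Fm n) (Δ : Tel m n) →
           Cell μ ∣ Δ ∣ → (Γ ,[ μ ∣ φ ]) ⧺ Δ ⊢ φ
    ⊤I   : ∀ {m} {Γ : Ctx m} → Γ ⊢ ⊤f
    ⊥E   : ∀ {m} {Γ : Ctx m} {φ : Fm m} → Γ ⊢ ⊥f → Γ ⊢ φ
    ∧I   : ∀ {m} {Γ : Ctx m} {φ ψ : Fm m} → Γ ⊢ φ → Γ ⊢ ψ → Γ ⊢ φ ∧f ψ
    ∧E₁  : ∀ {m} {Γ : Ctx m} {φ ψ : Fm m} → Γ ⊢ φ ∧f ψ → Γ ⊢ φ
    ∧E₂  : ∀ {m} {Γ : Ctx m} {φ ψ : Fm m} → Γ ⊢ φ ∧f ψ → Γ ⊢ ψ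
    ∨I₁  : ∀ {m} {Γ : Ctx m} {φ ψ : Fm m} → Γ ⊢ φ → Γ ⊢ φ ∨f ψ
    ∨I₂  : ∀ {m} {Γ : Ctx m} {φ ψ : Fm m} → Γ ⊢ ψ → Γ ⊢ φ ∨f ψ
    ∨E   : ∀ {m} {Γ : Ctx m} {φ ψ C : Fm m} → Γ ⊢ φ ∨f ψ →
           Γ ,[ id₁ ∣ φ ] ⊢ C → Γ ,[ id₁ ∣ ψ ] ⊢ C → Γ ⊢ C
    ⇒I   : ∀ {n m} {Γ : Ctx m} {μ : Hom n m} {φ : Fm n} {ψ : Fm m} →
           Γ ,[ μ ∣ φ ] ⊢ ψ → Γ ⊢ [ μ ∣ φ ]⇒ ψ
    ⇒E   : ∀ {n m} {Γ : Ctx m} {μ : Hom n m} {φ : Fm n} {ψ : Fm m} →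
           Γ ⊢ [ μ ∣ φ ]⇒ ψ → Γ lock μ ⊢ φ → Γ ⊢ ψ
    modI : ∀ {n m} {Γ : Ctx m} {μ : Hom n m} {φ : Fm n} →
           Γ lock μ ⊢ φ → Γ ⊢ ⟨ μ ∣ φ ⟩
    modE : ∀ {o' n m} {Γ : Ctx m} {ν : Hom o' n} {μ : Hom n m}
           {φ : Fm o'} {ψ : Fm m} →
           Γ lock μ ⊢ ⟨ ν ∣ φ ⟩ → Γ ,[ μ ∘ ν ∣ φ ] ⊢ ψ → Γ ⊢ ψ

-- A substitution from Γ to Δ is given Kripke-style: every variable (μ ∣ φ) of Γ, sitting
-- behind locks composing to ρ, is realised as a derivation of φ in every extension
-- Θ of Δ by variables and locks composing to κ, provided a 2-cell μ ⇒ ρ ∘ κ is given.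
-- Quantifying over extensions makes substitutions stable under adding variables
-- and locks, so they can be pushed under every rule; the identification of
-- contexts is absorbed by renamings, which move variables along 2-cells. The cut
-- is the substitution extending the identity by the derivation of Γ.lock_μ ⊢ φ,
-- pushed through Δ.
module Submission where

open import Defs
open import Level using (_⊔_)
open import Data.Product using (Σ; _,_; _×_; proj₁; proj₂)
open import Relation.Binary.PropositionalEquality using (_≡_; refl; sym; trans; subst)

module Substitution {o ℓ₁ ℓ₂} (M : ModeTheory o ℓ₁ ℓ₂) where
  open ModeTheory M
  open Syntax M

  private variable
    b j k m n : Mode
    μ ν ρ ρ' κ κ' : Hom n m
    φ ψ : Fm n
    Γ Γ' Δ Θ Θ' : Ctx m

  cast-cod : ρ ≡ ρ' → Cell μ ρ → Cell μ ρ'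
  cast-cod e α = subst (Cell _) e α

  ≡⇒Cell : μ ≡ ν → Cell μ ν
  ≡⇒Cell e = cast-cod e id₂

  data Var : Ctx m → Hom n j → Fm n → Hom m j → Set (o ⊔ ℓ₁) where
    here      : Var (Γ ,[ μ ∣ φ ]) μ φ id₁
    skip-var  : Var Γ μ φ ρ → Var (Γ ,[ ν ∣ ψ ]) μ φ ρ
    skip-lock : Var Γ μ φ ρ → (ν : Hom k m) → Var (Γ lock ν) μ φ (ρ ∘ ν)

  Var-⧺ : (T : Tel j m) → Var ((Γ ,[ μ ∣ φ ]) ⧺ T) μ φ ∣ T ∣
  Var-⧺ []             = here
  Var-⧺ (T ,[ ν ∣ ψ ]) = skip-var (Var-⧺ T)
  Var-⧺ (T lock ν)     = skip-lock (Var-⧺ T) ν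

  Var⇒⧺ : Var Γ μ φ ρ →
          Σ (Ctx j) λ Γ₀ → Σ (Tel j m) λ T → ((Γ₀ ,[ μ ∣ φ ]) ⧺ T ≡ Γ) × (∣ T ∣ ≡ ρ)
  Var⇒⧺ (here {Γ = Γ}) = Γ , [] , refl , refl
  Var⇒⧺ (skip-var {ν = ν} {ψ = ψ} v) with Var⇒⧺ v
  ... | Γ₀ , T , refl , refl = Γ₀ , T ,[ ν ∣ ψ ] , refl , refl
  Var⇒⧺ (skip-lock v ν) with Var⇒⧺ v
  ... | Γ₀ , T , refl , refl = Γ₀ , T lock ν , refl , refl

  var⊢ : Var Γ μ φ ρ → Cell μ ρ → Γ ⊢ φ
  var⊢ {μ = μ} {φ = φ} v α with Var⇒⧺ v
  ... | _ , T , refl , refl = var μ φ T α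

  Ren : Ctx m → Ctx m → Set (o ⊔ ℓ₁ ⊔ ℓ₂)
  Ren {m} Δ Γ = ∀ {n j} {μ : Hom n j} {φ : Fm n} {ρ : Hom m j} →
                Var Γ μ φ ρ → Σ (Hom m j) λ ρ' → Var Δ μ φ ρ' × Cell ρ ρ'

  ren-id : Ren Γ Γ
  ren-id v = _ , v , id₂

  ren-∘ : Ren Θ Δ → Ren Δ Γ → Ren Θ Γ
  ren-∘ r s v with s v
  ... | _ , v′ , β with r v′
  ... | _ , v″ , γ = _ , v″ , γ · β

  ren-ext : Ren Δ Γ → Ren (Δ ,[ ν ∣ ψ ]) (Γ ,[ ν ∣ ψ ])
  ren-ext r here = _ , here , id₂
  ren-ext r (skip-var v) with r v
  ... | _ , v′ , β = _ , skip-var v′ , β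

  ren-lock : (ν : Hom n m) → Ren Δ Γ → Ren (Δ lock ν) (Γ lock ν)
  ren-lock ν r (skip-lock v .ν) with r v
  ... | _ , v′ , β = _ , skip-lock v′ ν , β * id₂

  ≈⇒Ren : Γ ≈ Γ' → Ren Γ' Γ × Ren Γ Γ'
  ≈⇒Ren (lock-id Γ) =
    (λ { (skip-lock v _) → _ , v , ≡⇒Cell (∘-idʳ _) }) ,
    (λ v → _ , skip-lock v id₁ , ≡⇒Cell (sym (∘-idʳ _)))
  ≈⇒Ren (lock-comp Γ μ ν) =
    (λ { (skip-lock (skip-lock v _) _) → _ , skip-lock v (μ ∘ ν) , ≡⇒Cell (∘-assoc _ μ ν) }) ,
    (λ { (skip-lock v _) → _ , skip-lock (skip-lock v μ) ν , ≡⇒Cell (sym (∘-assoc _ μ ν)) })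
  ≈⇒Ren ≈-refl        = ren-id , ren-id
  ≈⇒Ren (≈-sym e)     = proj₂ (≈⇒Ren e) , proj₁ (≈⇒Ren e)
  ≈⇒Ren (≈-trans e f) = ren-∘ (proj₁ (≈⇒Ren f)) (proj₁ (≈⇒Ren e)) ,
                        ren-∘ (proj₂ (≈⇒Ren e)) (proj₂ (≈⇒Ren f))
  ≈⇒Ren (≈-ext μ φ e) = ren-ext (proj₁ (≈⇒Ren e)) , ren-ext (proj₂ (≈⇒Ren e))
  ≈⇒Ren (≈-lock μ e)  = ren-lock μ (proj₁ (≈⇒Ren e)) , ren-lock μ (proj₂ (≈⇒Ren e))

  data Ext (Δ : Ctx m) : Ctx k → Hom k m → Set (o ⊔ ℓ₁) where
    ext-id   : Ext Δ Δ id₁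
    ext-var  : Ext Δ Θ κ → Ext Δ (Θ ,[ ν ∣ ψ ]) κ
    ext-lock : Ext Δ Θ κ → (ν : Hom j k) → Ext Δ (Θ lock ν) (κ ∘ ν)

  cast-Ext : κ ≡ κ' → Ext Δ Θ κ → Ext Δ Θ κ'
  cast-Ext e x = subst (Ext _ _) e x

  ext-unlock : Ext (Δ lock ν) Θ κ → Ext Δ Θ (ν ∘ κ)
  ext-unlock {ν = ν} ext-id = cast-Ext (trans (∘-idˡ ν) (sym (∘-idʳ ν))) (ext-lock ext-id ν)
  ext-unlock (ext-var x)    = ext-var (ext-unlock x)
  ext-unlock {ν = ν} (ext-lock {κ = κ} x ν′) =
    cast-Ext (∘-assoc ν κ ν′) (ext-lock (ext-unlock x) ν′)

  ext-unvar : Ext (Δ ,[ ν ∣ ψ ]) Θ κ → Ext Δ Θ κ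
  ext-unvar ext-id         = ext-var ext-id
  ext-unvar (ext-var x)    = ext-var (ext-unvar x)
  ext-unvar (ext-lock x ν) = ext-lock (ext-unvar x) ν

  ext-∘ : Ext Δ Θ κ → Ext Θ Θ' κ' → Ext Δ Θ' (κ ∘ κ')
  ext-∘ {κ = κ} x ext-id = cast-Ext (sym (∘-idʳ κ)) x
  ext-∘ x (ext-var y)    = ext-var (ext-∘ x y)
  ext-∘ {κ = κ} x (ext-lock {κ = κ'} y ν) =
    cast-Ext (∘-assoc κ κ' ν) (ext-lock (ext-∘ x y) ν)

  Var-ext : Ext Δ Θ κ → Var Δ μ φ ρ → Var Θ μ φ (ρ ∘ κ)
  Var-ext {ρ = ρ} ext-id v = subst (Var _ _ _) (sym (∘-idʳ ρ)) v
  Var-ext (ext-var x) v    = skip-var (Var-ext x v)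
  Var-ext {ρ = ρ} (ext-lock {κ = κ} x ν) v =
    subst (Var _ _ _) (∘-assoc ρ κ ν) (skip-lock (Var-ext x v) ν)

  Sub : Ctx m → Ctx m → Set (o ⊔ ℓ₁ ⊔ ℓ₂)
  Sub {m} Δ Γ = ∀ {n j} {μ : Hom n j} {φ : Fm n} {ρ : Hom m j} → Var Γ μ φ ρ →
                ∀ {Θ : Ctx n} {κ : Hom n m} → Ext Δ Θ κ → Cell μ (ρ ∘ κ) → Θ ⊢ φ

  sub-id : Sub Γ Γ
  sub-id v x α = var⊢ (Var-ext x v) α

  sub-ren : Sub Δ Γ' → Ren Γ' Γ → Sub Δ Γ
  sub-ren s r v x α with r v
  ... | _ , v′ , β = s v′ x ((β * id₂) · α)

  sub-ext : Sub Δ Γ → Sub (Δ ,[ ν ∣ ψ ]) (Γ ,[ ν ∣ ψ ])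
  sub-ext s here           = sub-id here
  sub-ext s (skip-var v) x = s v (ext-unvar x)

  sub-lock : (ν : Hom n m) → Sub Δ Γ → Sub (Δ lock ν) (Γ lock ν)
  sub-lock ν s (skip-lock {ρ = ρ} v .ν) {κ = κ} x α =
    s v (ext-unlock x) (cast-cod (∘-assoc ρ ν κ) α)

  sub-⧺ : (T : Tel m b) → Sub Δ Γ → Sub (Δ ⧺ T) (Γ ⧺ T)
  sub-⧺ []             s = s
  sub-⧺ (T ,[ ν ∣ ψ ]) s = sub-ext (sub-⧺ T s)
  sub-⧺ (T lock ν)     s = sub-lock ν (sub-⧺ T s)

  sub : Sub Δ Γ → Γ ⊢ φ → Δ ⊢ φ
  sub s (conv e d)        = sub (sub-ren s (proj₁ (≈⇒Ren e))) d
  sub s (var μ φ T α)     = s (Var-⧺ T) ext-id (cast-cod (sym (∘-idʳ _)) α)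
  sub s ⊤I                = ⊤I
  sub s (⊥E d)            = ⊥E (sub s d)
  sub s (∧I d d′)         = ∧I (sub s d) (sub s d′)
  sub s (∧E₁ d)           = ∧E₁ (sub s d)
  sub s (∧E₂ d)           = ∧E₂ (sub s d)
  sub s (∨I₁ d)           = ∨I₁ (sub s d)
  sub s (∨I₂ d)           = ∨I₂ (sub s d)
  sub s (∨E d d₁ d₂)      = ∨E (sub s d) (sub (sub-ext s) d₁) (sub (sub-ext s) d₂)
  sub s (⇒I d)            = ⇒I (sub (sub-ext s) d)
  sub s (⇒E {μ = μ} d d′) = ⇒E (sub s d) (sub (sub-lock μ s) d′)
  sub s (modI {μ = μ} d)  = modI (sub (sub-lock μ s) d)
  sub s (modE {μ = μ} d d′) = modE (sub (sub-lock μ s) d) (sub (sub-ext s) d′)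

  sub-lock-⇒ : Ext Δ Θ κ → Cell μ κ → Sub Θ (Δ lock μ)
  sub-lock-⇒ {μ = μ} x α (skip-lock {ρ = ρ} v .μ) {κ = κ′} y β =
    sub-id v (ext-∘ x y) ((id₂ {μ = ρ} * (α * id₂ {μ = κ′})) · cast-cod (∘-assoc ρ μ κ′) β)

  sub-cons : Sub Δ Γ → Δ lock μ ⊢ φ → Sub Δ (Γ ,[ μ ∣ φ ])
  sub-cons s d here x α     = sub (sub-lock-⇒ x (cast-cod (∘-idˡ _) α)) d
  sub-cons s d (skip-var v) = s v

theorem3 : ∀ {o ℓ₁ ℓ₂} (M : ModeTheory o ℓ₁ ℓ₂) →
    let open ModeTheory M
        open Syntax M
    in ∀ {n m b : Mode} (μ : Hom n m) (Γ : Ctx m) (Δ : Tel m b)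
         (φ : Fm n) (ψ : Fm b) →
       Γ lock μ ⊢ φ →
       (Γ ,[ μ ∣ φ ]) ⧺ Δ ⊢ ψ →
       Γ ⧺ Δ ⊢ ψ
theorem3 M μ Γ Δ φ ψ d e = sub (sub-⧺ Δ (sub-cons sub-id d)) e
  where open Substitution M
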